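{- Let $\mathsf{K}$ be one of $\mathsf{ISL},\mathsf{bISL},\mathsf{PDL},\mathsf{IL},\mathsf{HA}$ and let $\Phi$ be a Sahlqvist quasiequation in the language of $\mathsf{K}$. For every $\boldsymbol{A}\in\mathsf{K}$, if $\boldsymbol{A}$ validates $\Phi$, then $\mathsf{Up}(\boldsymbol{A}_\ast)$ validates $\Phi$.
   Context: Varieties and languages: $\mathsf{ISL}$, implicative semilattices $\langle A;\wedge,\to,1\rangle$ ($a\to b$ the largest $c$ with $c\wedge a\le b$); $\mathsf{bISL}$, bounded implicative semilattices $\langle A;\wedge,\to,0,1\rangle$; $\mathsf{PDL}$, pseudocomplemented distributive lattices $\langle A;\wedge,\vee,\neg,0,1\rangle$; $\mathsf{IL}$, implicative lattices $\langle A;\wedge,\vee,\to,1\rangle$; $\mathsf{HA}$, Heyting algebras. Formulas over $\{\wedge,\vee,\to,\neg,0,1\}$ and a denumerable set of variables. An occurrence of a variable is positive (negative) if the number of negations and antecedents of implications within whose scope it lies is even (odd); a formula is positive (negative) if all variable occurrences are. Sahlqvist antecedent: built from variables, negative formulas and $0,1$ using only $\wedge,\vee$. Sahlqvist implication: a positive formula, or $\neg\varphi$ with $\varphi$ a Sahlqvist antecedent, or $\varphi\to\psi$ with $\varphi$ a Sahlqvist antecedent and $\psi$ positive. A Sahlqvist quasiequation is $\Phi=(\varphi_1\wedge y\le z\ \&\cdots\&\ \varphi_n\wedge y\le z\Longrightarrow y\le z)$ with $y,z$ distinct variables not in the $\varphi_i$, each $\varphi_i$ obtained from Sahlqvist implications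 using only $\wedge,\vee$, and $a\le b$ abbreviating $a\wedge b\approx a$; it is in the language of $\mathsf{K}$ if all $\varphi_i$ use only operations of that language; validity means satisfaction of its universal closure. $\boldsymbol{A}_\ast$ is the poset (under inclusion) of meet irreducible filters of $\langle A;\wedge\rangle$ (filter: nonempty upset closed under $\wedge$; meet irreducible: proper and not the intersection of two filters both different from it). $\mathsf{Up}(\mathbb{X})$ is the Heyting algebra of upsets of a poset $\mathbb{X}$ with $\cap,\cup$, $U\to V=X\setminus{\downarrow}(U\setminus V)$, $0=\emptyset$, $1=X$, $\neg U=U\to\emptyset$. -}

module Defs where

open import Level using (Level; Lift) renaming (zero to lzero; suc to lsuc)
open import Data.Nat using (ℕ)
open import Data.Fin using (Fin)
open import Data.Unit using (⊤; tt)
open import Data.Empty using (⊥)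
open import Data.Product using (Σ; ∃; _×_; _,_; proj₁; proj₂)
open import Data.Sum using (_⊎_)
open import Relation.Binary.PropositionalEquality using (_≡_; _≢_)
open import Relation.Nullary using (¬_)

data Variety : Set where
  ISL bISL PDL IL HA : Variety

HasImp : Variety → Set
HasImp ISL  = ⊤
HasImp bISL = ⊤
HasImp PDL  = ⊥
HasImp IL   = ⊤
HasImp HA   = ⊤

HasJoin : Variety → Set
HasJoin ISL  = ⊥
HasJoin bISL = ⊥
HasJoin PDL  = ⊤
HasJoin IL   = ⊤
HasJoin HA   = ⊤

HasBot : Variety → Set
HasBot ISL  = ⊥
HasBot bISL = ⊤
HasBot PDL  = ⊤
HasBot IL   = ⊥
HasBot HA   = ⊤

HasNeg : Variety → Set
HasNeg ISL  = ⊥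
HasNeg bISL = ⊥
HasNeg PDL  = ⊤
HasNeg IL   = ⊥
HasNeg HA   = ⊥

negBot : (K : Variety) → HasNeg K → HasBot K
negBot ISL  ()
negBot bISL ()
negBot PDL  _ = tt
negBot IL   ()
negBot HA   ()

data Fm (K : Variety) : Set where
  var  : ℕ → Fm K
  𝟙    : Fm K
  𝟘    : HasBot K → Fm K
  meet : Fm K → Fm K → Fm K
  join : HasJoin K → Fm K → Fm K → Fm K
  imp  : HasImp K → Fm K → Fm K → Fm K
  neg  : HasNeg K → Fm K → Fm K

Positive Negative : {K : Variety} → Fm K → Set
Positive (var x)      = ⊤
Positive 𝟙            = ⊤
Positive (𝟘 _)        = ⊤
Positive (meet φ ψ)   = Positive φ × Positive ψ
Positive (join _ φ ψ) = Positive φ × Positive ψ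
Positive (imp _ φ ψ)  = Negative φ × Positive ψ
Positive (neg _ φ)    = Negative φ
Negative (var x)      = ⊥
Negative 𝟙            = ⊤
Negative (𝟘 _)        = ⊤
Negative (meet φ ψ)   = Negative φ × Negative ψ
Negative (join _ φ ψ) = Negative φ × Negative ψ
Negative (imp _ φ ψ)  = Positive φ × Negative ψ
Negative (neg _ φ)    = Positive φ

Occurs : {K : Variety} → ℕ → Fm K → Set
Occurs x (var y)      = x ≡ y
Occurs x 𝟙            = ⊥
Occurs x (𝟘 _)        = ⊥
Occurs x (meet φ ψ)   = Occurs x φ ⊎ Occurs x ψ
Occurs x (join _ φ ψ) = Occurs x φ ⊎ Occurs x ψ
Occurs x (imp _ φ ψ)  = Occurs x φ ⊎ Occurs x ψ
Occurs x (neg _ φ)    = Occurs x φ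

data SAnte {K : Variety} : Fm K → Set where
  sa-var  : (x : ℕ) → SAnte (var x)
  sa-negf : (φ : Fm K) → Negative φ → SAnte φ
  sa-top  : SAnte 𝟙
  sa-bot  : (h : HasBot K) → SAnte (𝟘 h)
  sa-meet : {φ ψ : Fm K} → SAnte φ → SAnte ψ → SAnte (meet φ ψ)
  sa-join : (h : HasJoin K) {φ ψ : Fm K} → SAnte φ → SAnte ψ → SAnte (join h φ ψ)

data SImp {K : Variety} : Fm K → Set where
  si-pos : (φ : Fm K) → Positive φ → SImp φ
  si-neg : (h : HasNeg K) {φ : Fm K} → SAnte φ → SImp (neg h φ)
  si-imp : (h : HasImp K) {φ ψ : Fm K} → SAnte φ → Positive ψ → SImp (imp h φ ψ)

data SComb {K : Variety} : Fm K → Set where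
  sc-imp  : {φ : Fm K} → SImp φ → SComb φ
  sc-meet : {φ ψ : Fm K} → SComb φ → SComb ψ → SComb (meet φ ψ)
  sc-join : (h : HasJoin K) {φ ψ : Fm K} → SComb φ → SComb ψ → SComb (join h φ ψ)

-- A Sahlqvist quasiequation in the language of K:
--   φ₁ ∧ y ≤ z & … & φₙ ∧ y ≤ z ⟹ y ≤ z     (n = suc m ≥ 1)
record SahlqvistQE (K : Variety) : Set where
  field
    m      : ℕ
    φ      : Fin (ℕ.suc m) → Fm K
    y z    : ℕ
    y≢z    : y ≢ z
    y-fresh : ∀ i → ¬ Occurs y (φ i)
    z-fresh : ∀ i → ¬ Occurs z (φ i)
    sahl   : ∀ i → SComb (φ i)

record KAlgebra (K : Variety) : Set₁ where
  infixr 7 _∧_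
  field
    Carrier : Set
    _∧_  : Carrier → Carrier → Carrier
    one  : Carrier
    zer  : HasBot K → Carrier
    jn   : HasJoin K → Carrier → Carrier → Carrier
    im   : HasImp K → Carrier → Carrier → Carrier
    ng   : HasNeg K → Carrier → Carrier

  _≤_ : Carrier → Carrier → Set
  a ≤ b = a ∧ b ≡ a

  field
    ∧-assoc : ∀ a b c → (a ∧ b) ∧ c ≡ a ∧ (b ∧ c)
    ∧-comm  : ∀ a b → a ∧ b ≡ b ∧ a
    ∧-idem  : ∀ a → a ∧ a ≡ a
    one-top : ∀ a → a ∧ one ≡ a
    zer-bot : (h : HasBot K) → ∀ a → zer h ∧ a ≡ zer h
    ∨-assoc : (h : HasJoin K) → ∀ a b c → jn h (jn h a b) c ≡ jn h a (jn h b c)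
    ∨-comm  : (h : HasJoin K) → ∀ a b → jn h a b ≡ jn h b a
    absorb₁ : (h : HasJoin K) → ∀ a b → a ∧ jn h a b ≡ a
    absorb₂ : (h : HasJoin K) → ∀ a b → jn h a (a ∧ b) ≡ a
    distrib : (h : HasJoin K) → ∀ a b c → a ∧ jn h b c ≡ jn h (a ∧ b) (a ∧ c)
    residₗ  : (h : HasImp K) → ∀ a b c → c ≤ im h a b → (c ∧ a) ≤ b
    residᵣ  : (h : HasImp K) → ∀ a b c → (c ∧ a) ≤ b → c ≤ im h a b
    pcₗ     : (h : HasNeg K) → ∀ a c → c ≤ ng h a → c ∧ a ≡ zer (negBot K h)
    pcᵣ     : (h : HasNeg K) → ∀ a c → c ∧ a ≡ zer (negBot K h) → c ≤ ng h a

module _ {K : Variety} (A : KAlgebra K) where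
  open KAlgebra A

  eval : (ℕ → Carrier) → Fm K → Carrier
  eval v (var x)      = v x
  eval v 𝟙            = one
  eval v (𝟘 h)        = zer h
  eval v (meet φ ψ)   = eval v φ ∧ eval v ψ
  eval v (join h φ ψ) = jn h (eval v φ) (eval v ψ)
  eval v (imp h φ ψ)  = im h (eval v φ) (eval v ψ)
  eval v (neg h φ)    = ng h (eval v φ)

  Validates : SahlqvistQE K → Set
  Validates Φ = (v : ℕ → Carrier)
              → (∀ i → (eval v (φ i) ∧ v y) ≤ v z)
              → v y ≤ v z
    where open SahlqvistQE Φ

  _⊆F_ : (Carrier → Set) → (Carrier → Set) → Set
  F ⊆F G = ∀ a → F a → G a

  _≐F_ : (Carrier → Set) → (Carrier → Set) → Set
  F ≐F G = F ⊆F G × G ⊆F F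

  IsFilter : (Carrier → Set) → Set
  IsFilter F = (∃ λ a → F a)
             × (∀ a b → a ≤ b → F a → F b)
             × (∀ a b → F a → F b → F (a ∧ b))

  IsMeetIrreducible : (Carrier → Set) → Set₁
  IsMeetIrreducible F =
      IsFilter F
    × (∃ λ a → ¬ F a)
    × ¬ (Σ (Carrier → Set) λ G → Σ (Carrier → Set) λ H →
           IsFilter G × IsFilter H × ¬ (G ≐F F) × ¬ (H ≐F F)
           × (F ≐F (λ a → G a × H a)))

  Pt : Set₁
  Pt = Σ (Carrier → Set) IsMeetIrreducible

  _⊑_ : Pt → Pt → Set
  x ⊑ y = proj₁ x ⊆F proj₁ y

  Sub : Set₂
  Sub = Pt → Set₁

  IsUpset : Sub → Set₁
  IsUpset U = ∀ x x' → x ⊑ x' → U x → U x'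

  _⊆U_ : Sub → Sub → Set₁
  U ⊆U V = ∀ x → U x → V x

  _≐U_ : Sub → Sub → Set₁
  U ≐U V = U ⊆U V × V ⊆U U

  _∩U_ : Sub → Sub → Sub
  (U ∩U V) x = U x × V x

  _∪U_ : Sub → Sub → Sub
  (U ∪U V) x = U x ⊎ V x

  ∅U : Sub
  ∅U _ = Lift (lsuc lzero) ⊥

  XU : Sub
  XU _ = Lift (lsuc lzero) ⊤

  _⇒U_ : Sub → Sub → Sub
  (U ⇒U V) x = ¬ (Σ Pt λ x' → x ⊑ x' × U x' × ¬ V x')

  ¬U : Sub → Sub
  ¬U U = U ⇒U ∅U

  _≤U_ : Sub → Sub → Set₁
  U ≤U V = (U ∩U V) ≐U U

  evalU : (ℕ → Sub) → Fm K → Sub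
  evalU V (var x)      = V x
  evalU V 𝟙            = XU
  evalU V (𝟘 _)        = ∅U
  evalU V (meet φ ψ)   = evalU V φ ∩U evalU V ψ
  evalU V (join _ φ ψ) = evalU V φ ∪U evalU V ψ
  evalU V (imp _ φ ψ)  = evalU V φ ⇒U evalU V ψ
  evalU V (neg _ φ)    = ¬U (evalU V φ)

  UpValidates : SahlqvistQE K → Set₂
  UpValidates Φ = (V : ℕ → Sub) → (∀ n → IsUpset (V n))
                → (∀ i → (evalU V (φ i) ∩U V y) ≤U V z)
                → V y ≤U V z
    where open SahlqvistQE Φ

Zorn : (ℓ : Level) → Set (lsuc ℓ)
Zorn ℓ = (P : Set ℓ) (_≤_ : P → P → Set ℓ)
       → (∀ x → x ≤ x)
       → (∀ x y w → x ≤ y → y ≤ w → x ≤ w)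
       → ((C : P → Set ℓ) → (∀ x y → C x → C y → x ≤ y ⊎ y ≤ x)
            → Σ P λ u → ∀ c → C c → c ≤ u)
       → Σ P λ m → ∀ x → m ≤ x → x ≤ m

{-# OPTIONS --safe #-}
-- Fix an upset valuation V on A_* and a point x. If x lay in no ⟦φᵢ⟧, the Sahlqvist
-- shape of the φᵢ would let V be approximated, finitely many points at a time, by
-- valuations v in A: the valuation induced by all v compatible with V evaluates
-- positive formulas correctly, and every negative formula true at a point is already
-- true there under one compatible v. This yields v with φᵢ(v) ∉ x for all i. Being meet
-- irreducible, x is meet prime, so some c ∉ x lies above φᵢ(v) ∧ fᵢ with fᵢ ∈ x for
-- every i, and validity of Φ under y ↦ ⋀ fᵢ, z ↦ c puts c in x. Hence every point lies
-- in some ⟦φᵢ⟧ and ⟦y⟧ ⊆ ⟦z⟧. Zorn's lemma supplies the meet irreducible filters that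
-- separate a filter from a directed set.
module Submission where

open import Defs
open import Level using (_⊔_; Lift; lift; lower) renaming (zero to lzero; suc to lsuc)
open import Axiom.ExcludedMiddle using (ExcludedMiddle)
open import Data.Empty using (⊥; ⊥-elim)
open import Data.Unit using (⊤; tt)
open import Data.Product using (Σ; ∃; _×_; _,_; proj₁; proj₂)
open import Data.Sum using (_⊎_; inj₁; inj₂)
import Data.Sum as Sum
open import Data.Nat using (ℕ; _≟_)
import Data.Nat as ℕ
open import Data.Fin using (Fin; zero; suc)
open import Data.List using (List; []; _∷_; _++_; tabulate)
open import Data.List.Relation.Unary.All using (All; []; _∷_)
import Data.List.Relation.Unary.All as All
open import Data.List.Relation.Unary.All.Properties using (++⁻)
open import Data.List.Relation.Unary.Any using (Any; here; there)
import Data.List.Relation.Unary.Any as Any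
import Data.List.Relation.Unary.Any.Properties as Anyₚ
open import Function using (_∘_; id)
open import Relation.Binary.PropositionalEquality
  using (_≡_; _≢_; refl; sym; trans; cong; cong₂; subst; subst₂; module ≡-Reasoning)
open import Relation.Nullary using (¬_; yes; no)
open import Relation.Nullary.Decidable using (True; toWitness; fromWitness)
open import Relation.Unary using (Pred; _⊆_; _∩_)

module Order {K : Variety} (A : KAlgebra K) where
  open KAlgebra A
  open ≡-Reasoning

  ≤-refl : ∀ a → a ≤ a
  ≤-refl = ∧-idem

  ≡⇒≤ : ∀ {a b} → a ≡ b → a ≤ b
  ≡⇒≤ {a} refl = ≤-refl a

  ≤-trans : ∀ {a b c} → a ≤ b → b ≤ c → a ≤ c
  ≤-trans {a} {b} {c} a≤b b≤c = begin
    a ∧ c        ≡⟨ cong (_∧ c) (sym a≤b) ⟩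
    (a ∧ b) ∧ c  ≡⟨ ∧-assoc a b c ⟩
    a ∧ (b ∧ c)  ≡⟨ cong (a ∧_) b≤c ⟩
    a ∧ b        ≡⟨ a≤b ⟩
    a            ∎

  ≤-antisym : ∀ {a b} → a ≤ b → b ≤ a → a ≡ b
  ≤-antisym {a} {b} a≤b b≤a = trans (sym a≤b) (trans (∧-comm a b) b≤a)

  x∧y≤x : ∀ a b → (a ∧ b) ≤ a
  x∧y≤x a b = begin
    (a ∧ b) ∧ a  ≡⟨ ∧-assoc a b a ⟩
    a ∧ (b ∧ a)  ≡⟨ cong (a ∧_) (∧-comm b a) ⟩
    a ∧ (a ∧ b)  ≡⟨ sym (∧-assoc a a b) ⟩
    (a ∧ a) ∧ b  ≡⟨ cong (_∧ b) (∧-idem a) ⟩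
    a ∧ b        ∎

  x∧y≤y : ∀ a b → (a ∧ b) ≤ b
  x∧y≤y a b = begin
    (a ∧ b) ∧ b  ≡⟨ ∧-assoc a b b ⟩
    a ∧ (b ∧ b)  ≡⟨ cong (a ∧_) (∧-idem b) ⟩
    a ∧ b        ∎

  ∧-greatest : ∀ {a b c} → a ≤ b → a ≤ c → a ≤ (b ∧ c)
  ∧-greatest {a} {b} {c} a≤b a≤c = begin
    a ∧ (b ∧ c)  ≡⟨ sym (∧-assoc a b c) ⟩
    (a ∧ b) ∧ c  ≡⟨ cong (_∧ c) a≤b ⟩
    a ∧ c        ≡⟨ a≤c ⟩
    a            ∎

  ∧-mono : ∀ {a a′ b b′} → a ≤ a′ → b ≤ b′ → (a ∧ b) ≤ (a′ ∧ b′)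
  ∧-mono {a} {_} {b} a≤a′ b≤b′ =
    ∧-greatest (≤-trans (x∧y≤x a b) a≤a′) (≤-trans (x∧y≤y a b) b≤b′)

  ∧-monoˡ : ∀ {a a′} b → a ≤ a′ → (a ∧ b) ≤ (a′ ∧ b)
  ∧-monoˡ b a≤a′ = ∧-mono a≤a′ (≤-refl b)

  ∧-monoʳ : ∀ a {b b′} → b ≤ b′ → (a ∧ b) ≤ (a ∧ b′)
  ∧-monoʳ a b≤b′ = ∧-mono (≤-refl a) b≤b′

  ∧-interchange : ∀ a b c d → ((a ∧ b) ∧ (c ∧ d)) ≤ ((a ∧ c) ∧ (b ∧ d))
  ∧-interchange a b c d = ∧-greatest
    (∧-mono (x∧y≤x a b) (x∧y≤x c d))
    (∧-mono (x∧y≤y a b) (x∧y≤y c d))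

  ∧-swap-≤ : ∀ {a b c} → (a ∧ b) ≤ c → (b ∧ a) ≤ c
  ∧-swap-≤ {a} {b} = ≤-trans (∧-greatest (x∧y≤y b a) (x∧y≤x b a))

  ≤-one : ∀ a → a ≤ one
  ≤-one = one-top

  ≤-zer⇒≡ : ∀ {a} (h : HasBot K) → a ≤ zer h → a ≡ zer h
  ≤-zer⇒≡ {a} h a≤0 = ≤-antisym a≤0 (zer-bot h a)

  x≤x∨y : (h : HasJoin K) → ∀ a b → a ≤ jn h a b
  x≤x∨y = absorb₁

  y≤x∨y : (h : HasJoin K) → ∀ a b → b ≤ jn h a b
  y≤x∨y h a b = trans (cong (b ∧_) (∨-comm h a b)) (absorb₁ h b a)

  ∨-least : (h : HasJoin K) → ∀ {a b c} → a ≤ c → b ≤ c → jn h a b ≤ c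
  ∨-least h {a} {b} {c} a≤c b≤c = begin
    jn h a b ∧ c          ≡⟨ ∧-comm (jn h a b) c ⟩
    c ∧ jn h a b          ≡⟨ distrib h c a b ⟩
    jn h (c ∧ a) (c ∧ b)  ≡⟨ cong₂ (jn h) (trans (∧-comm c a) a≤c) (trans (∧-comm c b) b≤c) ⟩
    jn h a b              ∎

  ∨-mono : (h : HasJoin K) → ∀ {a a′ b b′} → a ≤ a′ → b ≤ b′ → jn h a b ≤ jn h a′ b′
  ∨-mono h {_} {a′} {_} {b′} a≤a′ b≤b′ =
    ∨-least h (≤-trans a≤a′ (x≤x∨y h a′ b′)) (≤-trans b≤b′ (y≤x∨y h a′ b′))

  ∧-distribʳ-∨-≤ : (h : HasJoin K) → ∀ {a b c d} → (a ∧ c) ≤ d → (b ∧ c) ≤ d → (jn h a b ∧ c) ≤ d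
  ∧-distribʳ-∨-≤ h {a} {b} {c} ac≤d bc≤d =
    ≤-trans (≡⇒≤ (trans (∧-comm _ c) (distrib h c a b)))
            (∨-least h (∧-swap-≤ ac≤d) (∧-swap-≤ bc≤d))

  has-⇒-or-∨ : (K : Variety) → HasImp K ⊎ HasJoin K
  has-⇒-or-∨ ISL  = inj₁ tt
  has-⇒-or-∨ bISL = inj₁ tt
  has-⇒-or-∨ PDL  = inj₂ tt
  has-⇒-or-∨ IL   = inj₁ tt
  has-⇒-or-∨ HA   = inj₁ tt

  ⇒-modusPonens : (h : HasImp K) → ∀ a b → (im h a b ∧ a) ≤ b
  ⇒-modusPonens h a b = residₗ h a b (im h a b) (≤-refl _)

  ⇒-mono : (h : HasImp K) → ∀ {a a′ b b′} → a′ ≤ a → b ≤ b′ → im h a b ≤ im h a′ b′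
  ⇒-mono h {a} {a′} {b} {b′} a′≤a b≤b′ = residᵣ h a′ b′ (im h a b)
    (≤-trans (∧-monoʳ _ a′≤a) (≤-trans (⇒-modusPonens h a b) b≤b′))

  ¬-contradiction : (h : HasNeg K) → ∀ a → ng h a ∧ a ≡ zer (negBot K h)
  ¬-contradiction h a = pcₗ h a (ng h a) (≤-refl _)

  ¬-antitone : (h : HasNeg K) → ∀ {a a′} → a′ ≤ a → ng h a ≤ ng h a′
  ¬-antitone h {a} {a′} a′≤a = pcᵣ h a′ (ng h a) (≤-zer⇒≡ (negBot K h)
    (≤-trans (∧-monoʳ _ a′≤a) (≡⇒≤ (¬-contradiction h a))))

  -- The only point where the language of K matters: it has ⇒ or ∨, giving e ⇒ c or g ∨ h.
  common-bound : ∀ {g h e c} → (g ∧ e) ≤ c → (h ∧ e) ≤ c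
               → ∃ λ k → g ≤ k × h ≤ k × (k ∧ e) ≤ c
  common-bound {g} {h} {e} {c} ge≤c he≤c with has-⇒-or-∨ K
  ... | inj₁ i = im i e c , residᵣ i e c g ge≤c , residᵣ i e c h he≤c , ⇒-modusPonens i e c
  ... | inj₂ j = jn j g h , x≤x∨y j g h , y≤x∨y j g h , ∧-distribʳ-∨-≤ j ge≤c he≤c

  ⋀ : ∀ n → (Fin n → Carrier) → Carrier
  ⋀ ℕ.zero    f = one
  ⋀ (ℕ.suc n) f = f zero ∧ ⋀ n (f ∘ suc)

  ⋀-lower : ∀ n f i → ⋀ n f ≤ f i
  ⋀-lower (ℕ.suc n) f zero    = x∧y≤x _ _
  ⋀-lower (ℕ.suc n) f (suc i) = ≤-trans (x∧y≤y _ _) (⋀-lower n (f ∘ suc) i)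

module Valuations {K : Variety} (A : KAlgebra K) where
  open KAlgebra A
  open Order A

  Val : Set
  Val = ℕ → Carrier

  _≤v_ : Val → Val → Set
  v ≤v v′ = ∀ p → v p ≤ v′ p

  _∧v_ : Val → Val → Val
  (v ∧v v′) p = v p ∧ v′ p

  ⊤v : Val
  ⊤v _ = one

  ≤v-refl : ∀ v → v ≤v v
  ≤v-refl v p = ≤-refl (v p)

  ∧v-lowerˡ : ∀ v v′ → (v ∧v v′) ≤v v
  ∧v-lowerˡ v v′ p = x∧y≤x (v p) (v′ p)

  ∧v-lowerʳ : ∀ v v′ → (v ∧v v′) ≤v v′
  ∧v-lowerʳ v v′ p = x∧y≤y (v p) (v′ p)

  eval-monotone : ∀ χ → Positive χ → ∀ {v v′} → v ≤v v′ → eval A v χ ≤ eval A v′ χ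
  eval-antitone : ∀ ν → Negative ν → ∀ {v v′} → v ≤v v′ → eval A v′ ν ≤ eval A v ν
  eval-monotone (var x)      _       v≤v′ = v≤v′ x
  eval-monotone 𝟙            _       _    = ≤-refl one
  eval-monotone (𝟘 h)        _       _    = ≤-refl (zer h)
  eval-monotone (meet φ ψ)   (p , q) v≤v′ = ∧-mono (eval-monotone φ p v≤v′) (eval-monotone ψ q v≤v′)
  eval-monotone (join h φ ψ) (p , q) v≤v′ = ∨-mono h (eval-monotone φ p v≤v′) (eval-monotone ψ q v≤v′)
  eval-monotone (imp h φ ψ)  (n , p) v≤v′ = ⇒-mono h (eval-antitone φ n v≤v′) (eval-monotone ψ p v≤v′)
  eval-monotone (neg h φ)    n       v≤v′ = ¬-antitone h (eval-antitone φ n v≤v′)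
  eval-antitone (var x)      ()
  eval-antitone 𝟙            _       _    = ≤-refl one
  eval-antitone (𝟘 h)        _       _    = ≤-refl (zer h)
  eval-antitone (meet φ ψ)   (n , m) v≤v′ = ∧-mono (eval-antitone φ n v≤v′) (eval-antitone ψ m v≤v′)
  eval-antitone (join h φ ψ) (n , m) v≤v′ = ∨-mono h (eval-antitone φ n v≤v′) (eval-antitone ψ m v≤v′)
  eval-antitone (imp h φ ψ)  (p , n) v≤v′ = ⇒-mono h (eval-monotone φ p v≤v′) (eval-antitone ψ n v≤v′)
  eval-antitone (neg h φ)    p       v≤v′ = ¬-antitone h (eval-monotone φ p v≤v′)

  eval-cong : ∀ φ {v v′} → (∀ p → Occurs p φ → v p ≡ v′ p) → eval A v φ ≡ eval A v′ φ
  eval-cong (var x)      v≈v′ = v≈v′ x refl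
  eval-cong 𝟙            v≈v′ = refl
  eval-cong (𝟘 h)        v≈v′ = refl
  eval-cong (meet φ ψ)   v≈v′ =
    cong₂ _∧_ (eval-cong φ (λ p o → v≈v′ p (inj₁ o))) (eval-cong ψ (λ p o → v≈v′ p (inj₂ o)))
  eval-cong (join h φ ψ) v≈v′ =
    cong₂ (jn h) (eval-cong φ (λ p o → v≈v′ p (inj₁ o))) (eval-cong ψ (λ p o → v≈v′ p (inj₂ o)))
  eval-cong (imp h φ ψ)  v≈v′ =
    cong₂ (im h) (eval-cong φ (λ p o → v≈v′ p (inj₁ o))) (eval-cong ψ (λ p o → v≈v′ p (inj₂ o)))
  eval-cong (neg h φ)    v≈v′ = cong (ng h) (eval-cong φ v≈v′)

  _[_≔_] : Val → ℕ → Carrier → Val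
  (v [ p ≔ a ]) q with q ≟ p
  ... | yes _ = a
  ... | no  _ = v q

  update-≡ : ∀ v p a → (v [ p ≔ a ]) p ≡ a
  update-≡ v p a with p ≟ p
  ... | yes _   = refl
  ... | no  p≢p = ⊥-elim (p≢p refl)

  update-≢ : ∀ v {p q} a → q ≢ p → (v [ p ≔ a ]) q ≡ v q
  update-≢ v {p} {q} a q≢p with q ≟ p
  ... | yes q≡p = ⊥-elim (q≢p q≡p)
  ... | no  _   = refl

module Points {K : Variety} (A : KAlgebra K) where
  open KAlgebra A
  open Order A

  Point : Set₁
  Point = Pt A

  infix 4 _∈_ _∉_

  _∈_ : Carrier → Point → Set
  a ∈ x = proj₁ x a

  _∉_ : Carrier → Point → Set
  a ∉ x = ¬ a ∈ x

  ∈-up : (x : Point) → ∀ {a b} → a ≤ b → a ∈ x → b ∈ x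
  ∈-up (_ , (_ , up , _) , _) = up _ _

  ∈-∧ : (x : Point) → ∀ {a b} → a ∈ x → b ∈ x → (a ∧ b) ∈ x
  ∈-∧ (_ , (_ , _ , closed) , _) = closed _ _

  one-∈ : (x : Point) → one ∈ x
  one-∈ x@(_ , ((a , a∈x) , _) , _) = ∈-up x (≤-one a) a∈x

  ∧-∈ˡ : (x : Point) → ∀ {a b} → (a ∧ b) ∈ x → a ∈ x
  ∧-∈ˡ x = ∈-up x (x∧y≤x _ _)

  ∧-∈ʳ : (x : Point) → ∀ {a b} → (a ∧ b) ∈ x → b ∈ x
  ∧-∈ʳ x = ∈-up x (x∧y≤y _ _)

  proper : (x : Point) → ∃ λ a → a ∉ x
  proper (_ , _ , ∉x , _) = ∉x

  zer-∉ : (x : Point) (h : HasBot K) → zer h ∉ x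
  zer-∉ x h 0∈x = proj₂ (proper x) (∈-up x (zer-bot h _) 0∈x)

  ¬-∉ : (x : Point) (h : HasNeg K) → ∀ {a} → ng h a ∈ x → a ∉ x
  ¬-∉ x h ¬a∈x a∈x =
    zer-∉ x (negBot K h) (∈-up x (≡⇒≤ (¬-contradiction h _)) (∈-∧ x ¬a∈x a∈x))

  ⋀-∈ : (x : Point) → ∀ n {f} → (∀ i → f i ∈ x) → ⋀ n f ∈ x
  ⋀-∈ x ℕ.zero    f∈x = one-∈ x
  ⋀-∈ x (ℕ.suc n) f∈x = ∈-∧ x (f∈x zero) (⋀-∈ x n (f∈x ∘ suc))

  ⇒-∈ : (x : Point) (h : HasImp K) → ∀ {a b} → im h a b ∈ x → a ∈ x → b ∈ x
  ⇒-∈ x h a⇒b∈x a∈x = ∈-up x (⇒-modusPonens h _ _) (∈-∧ x a⇒b∈x a∈x)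

module Classical (em : ExcludedMiddle (lsuc lzero)) where

  dne : {P : Set₁} → ¬ ¬ P → P
  dne {P} ¬¬p with em {P}
  ... | yes p  = p
  ... | no  ¬p = ⊥-elim (¬¬p ¬p)

  dne₀ : {P : Set} → ¬ ¬ P → P
  dne₀ ¬¬p = lower (dne (λ ¬p → ¬¬p (λ p → ¬p (lift p))))

  ⊈-witness : {X : Set} {P : Pred X (lsuc lzero)} {Q : Pred X lzero}
            → ¬ (P ⊆ Q) → Σ X λ a → P a × ¬ Q a
  ⊈-witness P⊈Q = dne λ ¬∃ → P⊈Q λ {a} pa → dne₀ λ ¬qa → ¬∃ (a , pa , ¬qa)

  -- Deciding each instance makes a Set₁-valued predicate equivalent to a Set-valued one.
  Resize : {X : Set} → Pred X (lsuc lzero) → Pred X lzero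
  Resize P a = True (em {P a})

  resize : {X : Set} {P : Pred X (lsuc lzero)} {a : X} → P a → Resize P a
  resize = fromWitness

  unresize : {X : Set} {P : Pred X (lsuc lzero)} {a : X} → Resize P a → P a
  unresize = toWitness

module Filters (em : ExcludedMiddle (lsuc lzero)) {K : Variety} (A : KAlgebra K) where
  open KAlgebra A
  open Order A
  open Points A
  open Classical em

  record IsFilter₁ (G : Pred Carrier (lsuc lzero)) : Set₁ where
    field
      up       : ∀ {a b} → a ≤ b → G a → G b
      ∧-closed : ∀ {a b} → G a → G b → G (a ∧ b)
      one∈     : G one

  open IsFilter₁

  resize-isFilter : ∀ {G} → IsFilter₁ G → IsFilter A (Resize G)
  resize-isFilter {G} G-filter =
      (one , resize {P = G} (one∈ G-filter))
    , (λ a b a≤b a∈G → resize {P = G} (up G-filter a≤b (unresize {P = G} a∈G)))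
    , (λ a b a∈G b∈G →
         resize {P = G} (∧-closed G-filter (unresize {P = G} a∈G) (unresize {P = G} b∈G)))

  ↑_ : Carrier → Pred Carrier (lsuc lzero)
  (↑ a) b = Lift (lsuc lzero) (a ≤ b)

  ↑-isFilter : ∀ a → IsFilter₁ (↑ a)
  ↑-isFilter a = record
    { up       = λ b≤c a≤b → lift (≤-trans (lower a≤b) b≤c)
    ; ∧-closed = λ a≤b a≤c → lift (∧-greatest (lower a≤b) (lower a≤c))
    ; one∈     = lift (≤-one a)
    }

  ⋂ : ∀ {ℓ} {I : Set ℓ} → (I → Pred Carrier (lsuc lzero)) → List I → Pred Carrier (lsuc lzero)
  ⋂ G []       a = Lift (lsuc lzero) ⊤
  ⋂ G (i ∷ is) a = G i a × ⋂ G is a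

  ⋂-isFilter : ∀ {ℓ} {I : Set ℓ} {G : I → Pred Carrier (lsuc lzero)}
             → (∀ i → IsFilter₁ (G i)) → ∀ is → IsFilter₁ (⋂ G is)
  ⋂-isFilter G-filter []       =
    record { up = λ _ _ → lift tt ; ∧-closed = λ _ _ → lift tt ; one∈ = lift tt }
  ⋂-isFilter {G = G} G-filter (i ∷ is) = record
    { up       = λ a≤b (a∈Gi , a∈⋂) → up (G-filter i) a≤b a∈Gi , up rest a≤b a∈⋂
    ; ∧-closed = λ (a∈Gi , a∈⋂) (b∈Gi , b∈⋂) →
                   ∧-closed (G-filter i) a∈Gi b∈Gi , ∧-closed rest a∈⋂ b∈⋂
    ; one∈     = one∈ (G-filter i) , one∈ rest
    }
    where
    rest : IsFilter₁ (⋂ G is)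
    rest = ⋂-isFilter G-filter is

  ⋂-tabulate⁻ : ∀ {ℓ} {I : Set ℓ} {G : I → Pred Carrier (lsuc lzero)} {n} (f : Fin n → I) {a}
              → ⋂ G (tabulate f) a → ∀ i → G (f i) a
  ⋂-tabulate⁻ {n = ℕ.suc n} f (a∈G₀ , _)  zero    = a∈G₀
  ⋂-tabulate⁻ {n = ℕ.suc n} f (_ , a∈Gₛ) (suc i) = ⋂-tabulate⁻ (f ∘ suc) a∈Gₛ i

  _∨ᶠ_ : Pred Carrier (lsuc lzero) → Point → Pred Carrier (lsuc lzero)
  (G ∨ᶠ x) a = Σ Carrier λ g → Σ Carrier λ f → G g × f ∈ x × (g ∧ f) ≤ a

  ∨ᶠ-isFilter : ∀ {G} → IsFilter₁ G → (x : Point) → IsFilter₁ (G ∨ᶠ x)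
  ∨ᶠ-isFilter G-filter x = record
    { up       = λ { a≤b (g , f , g∈G , f∈x , gf≤a) → g , f , g∈G , f∈x , ≤-trans gf≤a a≤b }
    ; ∧-closed = λ { (g , f , g∈G , f∈x , gf≤a) (g′ , f′ , g′∈G , f′∈x , gf′≤b) →
                     g ∧ g′ , f ∧ f′ , ∧-closed G-filter g∈G g′∈G , ∈-∧ x f∈x f′∈x
                   , ≤-trans (∧-interchange g g′ f f′) (∧-mono gf≤a gf′≤b) }
    ; one∈     = one , one , one∈ G-filter , one-∈ x , x∧y≤x one one
    }

  ∨ᶠ-upperˡ : ∀ {G} (x : Point) → G ⊆ (G ∨ᶠ x)
  ∨ᶠ-upperˡ x {g} g∈G = g , one , g∈G , one-∈ x , x∧y≤x g one

  ∨ᶠ-upperʳ : ∀ {G} → IsFilter₁ G → (x : Point) → (_∈ x) ⊆ (G ∨ᶠ x)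
  ∨ᶠ-upperʳ G-filter x {f} f∈x = one , f , one∈ G-filter , f∈x , x∧y≤y one f

  ∨ᶠ-∩-⊆ : ∀ {G H} → IsFilter₁ G → IsFilter₁ H → (x : Point)
        → (G ∩ H) ⊆ (_∈ x) → ((G ∨ᶠ x) ∩ (H ∨ᶠ x)) ⊆ (_∈ x)
  ∨ᶠ-∩-⊆ G-filter H-filter x G∩H⊆x ((g , f , g∈G , f∈x , gf≤c) , (h , f′ , h∈H , f′∈x , hf′≤c)) =
    let (k , g≤k , h≤k , ke≤c) = common-bound (≤-trans (∧-monoʳ g (x∧y≤x f f′)) gf≤c)
                                              (≤-trans (∧-monoʳ h (x∧y≤y f f′)) hf′≤c)
    in ∈-up x ke≤c (∈-∧ x (G∩H⊆x (up G-filter g≤k g∈G , up H-filter h≤k h∈H))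
                          (∈-∧ x f∈x f′∈x))

  meet-prime : ∀ {G H} → IsFilter₁ G → IsFilter₁ H → (x : Point)
             → (G ∩ H) ⊆ (_∈ x) → G ⊆ (_∈ x) ⊎ H ⊆ (_∈ x)
  meet-prime {G} {H} G-filter H-filter x@(_ , _ , _ , irreducible) G∩H⊆x = dne λ ¬prime →
    let (g , g∈G , g∉x) = ⊈-witness (¬prime ∘ inj₁)
        (h , h∈H , h∉x) = ⊈-witness (¬prime ∘ inj₂)
    in irreducible
         ( Resize (G ∨ᶠ x) , Resize (H ∨ᶠ x)
         , resize-isFilter (∨ᶠ-isFilter G-filter x) , resize-isFilter (∨ᶠ-isFilter H-filter x)
         , (λ (G∨ᶠx⊆x , _) → g∉x (G∨ᶠx⊆x g (resize {P = G ∨ᶠ x} (∨ᶠ-upperˡ x g∈G))))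
         , (λ (H∨ᶠx⊆x , _) → h∉x (H∨ᶠx⊆x h (resize {P = H ∨ᶠ x} (∨ᶠ-upperˡ x h∈H))))
         , (λ a a∈x → resize {P = G ∨ᶠ x} (∨ᶠ-upperʳ G-filter x a∈x)
                    , resize {P = H ∨ᶠ x} (∨ᶠ-upperʳ H-filter x a∈x))
         , λ a (a∈G∨ᶠx , a∈H∨ᶠx) → ∨ᶠ-∩-⊆ G-filter H-filter x G∩H⊆x
                                     (unresize {P = G ∨ᶠ x} a∈G∨ᶠx , unresize {P = H ∨ᶠ x} a∈H∨ᶠx))

  meet-prime-⋂ : ∀ {ℓ} {I : Set ℓ} {G : I → Pred Carrier (lsuc lzero)} → (∀ i → IsFilter₁ (G i))
               → (x : Point) → ∀ is → ⋂ G is ⊆ (_∈ x) → Any (λ i → G i ⊆ (_∈ x)) is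
  meet-prime-⋂ G-filter x []       ⋂⊆x = ⊥-elim (proj₂ (proper x) (⋂⊆x (lift tt)))
  meet-prime-⋂ G-filter x (i ∷ is) ⋂⊆x =
    Sum.[ here , there ∘ meet-prime-⋂ G-filter x is ]′
      (meet-prime (G-filter i) (⋂-isFilter G-filter is) x ⋂⊆x)

  ∨-prime : (j : HasJoin K) (x : Point) → ∀ {a b} → jn j a b ∈ x → a ∈ x ⊎ b ∈ x
  ∨-prime j x {a} {b} a∨b∈x =
    Sum.map (λ ↑a⊆x → ↑a⊆x (lift (≤-refl a))) (λ ↑b⊆x → ↑b⊆x (lift (≤-refl b)))
      (meet-prime (↑-isFilter a) (↑-isFilter b) x
         λ (a≤c , b≤c) → ∈-up x (∨-least j (lower a≤c) (lower b≤c)) a∨b∈x)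

  Directed : Pred Carrier (lsuc lzero) → Set₁
  Directed S = ∀ {s₁ s₂} → S s₁ → S s₂ → Σ Carrier λ s → S s × s₁ ≤ s × s₂ ≤ s

  module Separation (zorn : Zorn (lsuc lzero)) {B S : Pred Carrier (lsuc lzero)}
                    (B-filter : IsFilter₁ B) (S-directed : Directed S)
                    (disjoint : ∀ {a} → B a → S a → ⊥) where

    record Candidate : Set₁ where
      field
        F        : Pred Carrier lzero
        isFilter : IsFilter A F
        B⊆F      : B ⊆ F
        avoids   : ∀ {a} → S a → ¬ F a

      F-up : ∀ {a b} → a ≤ b → F a → F b
      F-up = let (_ , up , _) = isFilter in up _ _

      F-∧ : ∀ {a b} → F a → F b → F (a ∧ b)
      F-∧ = let (_ , _ , closed) = isFilter in closed _ _

    open Candidate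

    _≼_ : Candidate → Candidate → Set₁
    P ≼ Q = Lift (lsuc lzero) (F P ⊆ F Q)

    chain-bound : (C : Candidate → Set₁) → (∀ P Q → C P → C Q → P ≼ Q ⊎ Q ≼ P)
                → Σ Candidate λ U → ∀ P → C P → P ≼ U
    chain-bound C comparable =
        record { F        = Resize ⋃C
               ; isFilter = resize-isFilter ⋃C-isFilter
               ; B⊆F      = resize {P = ⋃C} ∘ inj₁
               ; avoids   = λ s∈S s∈⋃C → ⋃C-avoids s∈S (unresize {P = ⋃C} s∈⋃C) }
      , λ P P∈C → lift λ a∈P → resize {P = ⋃C} (inj₂ (P , P∈C , a∈P))
      where
      ⋃C : Pred Carrier (lsuc lzero)
      ⋃C a = B a ⊎ Σ Candidate λ P → C P × F P a

      ∧-closed-⋃C : ∀ {a b} → ⋃C a → ⋃C b → ⋃C (a ∧ b)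
      ∧-closed-⋃C (inj₁ a∈B) (inj₁ b∈B) = inj₁ (∧-closed B-filter a∈B b∈B)
      ∧-closed-⋃C (inj₁ a∈B) (inj₂ (Q , Q∈C , b∈Q)) = inj₂ (Q , Q∈C , F-∧ Q (B⊆F Q a∈B) b∈Q)
      ∧-closed-⋃C (inj₂ (P , P∈C , a∈P)) (inj₁ b∈B) = inj₂ (P , P∈C , F-∧ P a∈P (B⊆F P b∈B))
      ∧-closed-⋃C (inj₂ (P , P∈C , a∈P)) (inj₂ (Q , Q∈C , b∈Q)) with comparable P Q P∈C Q∈C
      ... | inj₁ (lift P⊆Q) = inj₂ (Q , Q∈C , F-∧ Q (P⊆Q a∈P) b∈Q)
      ... | inj₂ (lift Q⊆P) = inj₂ (P , P∈C , F-∧ P a∈P (Q⊆P b∈Q))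

      ⋃C-isFilter : IsFilter₁ ⋃C
      ⋃C-isFilter = record
        { up       = λ { a≤b (inj₁ a∈B) → inj₁ (up B-filter a≤b a∈B)
                       ; a≤b (inj₂ (P , P∈C , a∈P)) → inj₂ (P , P∈C , F-up P a≤b a∈P) }
        ; ∧-closed = ∧-closed-⋃C
        ; one∈     = inj₁ (one∈ B-filter)
        }

      ⋃C-avoids : ∀ {a} → S a → ¬ ⋃C a
      ⋃C-avoids s∈S (inj₁ s∈B)            = disjoint s∈B s∈S
      ⋃C-avoids s∈S (inj₂ (P , _ , s∈P)) = avoids P s∈S s∈P

    maximal : Σ Candidate λ M → ∀ P → M ≼ P → P ≼ M
    maximal = zorn Candidate _≼_ (λ _ → lift λ a∈P → a∈P)
                   (λ _ _ _ (lift P⊆Q) (lift Q⊆R) → lift (Q⊆R ∘ P⊆Q)) chain-bound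

    maximal-point : ∀ {s₀} → S s₀ → Σ Point λ x → B ⊆ (_∈ x) × (∀ {a} → S a → a ∉ x)
    maximal-point {s₀} s₀∈S =
      (F M , isFilter M , (s₀ , avoids M s₀∈S) , irreducible) , B⊆F M , avoids M
      where
      M : Candidate
      M = proj₁ maximal

      -- By maximality a filter strictly above M is no candidate, so it meets S.
      meets-S : ∀ {G} → IsFilter A G → ¬ (_≐F_ A G (F M)) → _⊆F_ A (F M) G
              → Σ Carrier λ s → S s × G s
      meets-S {G} G-filter G≠M M⊆G = dne λ G∩S=∅ →
        let G-candidate = record { F = G ; isFilter = G-filter ; B⊆F = M⊆G _ ∘ B⊆F M
                                 ; avoids = λ s∈S s∈G → G∩S=∅ (_ , s∈S , s∈G) }
        in G≠M ((λ a → lower (proj₂ maximal G-candidate (lift (M⊆G _))) {a}) , M⊆G)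

      irreducible : ¬ (Σ (Pred Carrier lzero) λ G → Σ (Pred Carrier lzero) λ H →
                         IsFilter A G × IsFilter A H × ¬ (_≐F_ A G (F M)) × ¬ (_≐F_ A H (F M))
                         × _≐F_ A (F M) (λ a → G a × H a))
      irreducible (G , H , G-filter , H-filter , G≠M , H≠M , M≐G∩H) =
        let (s₁ , s₁∈S , s₁∈G) = meets-S G-filter G≠M (λ a → proj₁ ∘ proj₁ M≐G∩H a)
            (s₂ , s₂∈S , s₂∈H) = meets-S H-filter H≠M (λ a → proj₂ ∘ proj₁ M≐G∩H a)
            (s , s∈S , s₁≤s , s₂≤s) = S-directed s₁∈S s₂∈S
            (_ , G-up , _) = G-filter
            (_ , H-up , _) = H-filter
        in avoids M s∈S (proj₂ M≐G∩H s (G-up s₁ s s₁≤s s₁∈G , H-up s₂ s s₂≤s s₂∈H))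

  separation : Zorn (lsuc lzero) → ∀ {B S} → IsFilter₁ B → Directed S → (∀ {a} → B a → S a → ⊥)
             → ∀ {s₀} → S s₀ → Σ Point λ x → B ⊆ (_∈ x) × (∀ {a} → S a → a ∉ x)
  separation zorn B-filter S-directed disjoint =
    Separation.maximal-point zorn B-filter S-directed disjoint

module UpEvaluation {K : Variety} (A : KAlgebra K) where

  evalU-monotone : ∀ χ → Positive χ → ∀ {V₁ V₂} → (∀ p → _⊆U_ A (V₁ p) (V₂ p))
                 → _⊆U_ A (evalU A V₁ χ) (evalU A V₂ χ)
  evalU-antitone : ∀ ν → Negative ν → ∀ {V₁ V₂} → (∀ p → _⊆U_ A (V₁ p) (V₂ p))
                 → _⊆U_ A (evalU A V₂ ν) (evalU A V₁ ν)
  evalU-monotone (var p)      _       V₁⊆V₂ = V₁⊆V₂ p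
  evalU-monotone 𝟙            _       _     _ x∈ = x∈
  evalU-monotone (𝟘 h)        _       _     _ x∈ = x∈
  evalU-monotone (meet φ ψ)   (p , q) V₁⊆V₂ x (x∈φ , x∈ψ) =
    evalU-monotone φ p V₁⊆V₂ x x∈φ , evalU-monotone ψ q V₁⊆V₂ x x∈ψ
  evalU-monotone (join h φ ψ) (p , q) V₁⊆V₂ x =
    Sum.map (evalU-monotone φ p V₁⊆V₂ x) (evalU-monotone ψ q V₁⊆V₂ x)
  evalU-monotone (imp h φ ψ)  (n , p) V₁⊆V₂ x x∈φ⇒ψ (x′ , x⊑x′ , x′∈φ , x′∉ψ) =
    x∈φ⇒ψ (x′ , x⊑x′ , evalU-antitone φ n V₁⊆V₂ x′ x′∈φ , x′∉ψ ∘ evalU-monotone ψ p V₁⊆V₂ x′)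
  evalU-monotone (neg h φ)    n       V₁⊆V₂ x x∈¬φ (x′ , x⊑x′ , x′∈φ , x′∉∅) =
    x∈¬φ (x′ , x⊑x′ , evalU-antitone φ n V₁⊆V₂ x′ x′∈φ , x′∉∅)
  evalU-antitone (var p)      ()
  evalU-antitone 𝟙            _       _     _ x∈ = x∈
  evalU-antitone (𝟘 h)        _       _     _ x∈ = x∈
  evalU-antitone (meet φ ψ)   (n , m) V₁⊆V₂ x (x∈φ , x∈ψ) =
    evalU-antitone φ n V₁⊆V₂ x x∈φ , evalU-antitone ψ m V₁⊆V₂ x x∈ψ
  evalU-antitone (join h φ ψ) (n , m) V₁⊆V₂ x =
    Sum.map (evalU-antitone φ n V₁⊆V₂ x) (evalU-antitone ψ m V₁⊆V₂ x)
  evalU-antitone (imp h φ ψ)  (p , n) V₁⊆V₂ x x∈φ⇒ψ (x′ , x⊑x′ , x′∈φ , x′∉ψ) =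
    x∈φ⇒ψ (x′ , x⊑x′ , evalU-monotone φ p V₁⊆V₂ x′ x′∈φ , x′∉ψ ∘ evalU-antitone ψ n V₁⊆V₂ x′)
  evalU-antitone (neg h φ)    p       V₁⊆V₂ x x∈¬φ (x′ , x⊑x′ , x′∈φ , x′∉∅) =
    x∈¬φ (x′ , x⊑x′ , evalU-monotone φ p V₁⊆V₂ x′ x′∈φ , x′∉∅)

module Sahlqvist (em : ExcludedMiddle (lsuc lzero)) (zorn : Zorn (lsuc lzero))
                 {K : Variety} (A : KAlgebra K) (V : ℕ → Sub A) (V-upset : ∀ p → IsUpset A (V p)) where
  open KAlgebra A
  open Order A
  open Valuations A
  open Points A
  open Classical em
  open Filters em A
  open IsFilter₁
  open UpEvaluation A

  ⟦_⟧ : Fm K → Sub A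
  ⟦_⟧ = evalU A V

  Admissible : ℕ → Point → Pred Carrier (lsuc lzero)
  Admissible p w a = V p w → a ∈ w

  Admissible-isFilter : ∀ p w → IsFilter₁ (Admissible p w)
  Admissible-isFilter p w = record
    { up       = λ a≤b a∈ w∈Vp → ∈-up w a≤b (a∈ w∈Vp)
    ; ∧-closed = λ a∈ b∈ w∈Vp → ∈-∧ w (a∈ w∈Vp) (b∈ w∈Vp)
    ; one∈     = λ _ → one-∈ w
    }

  Compatible : Point → Pred Val (lsuc lzero)
  Compatible w v = ∀ p → Admissible p w (v p)

  Compatible* : List Point → Pred Val (lsuc lzero)
  Compatible* W v = All (λ w → Compatible w v) W

  ⊤v-compatible : ∀ W → Compatible* W ⊤v
  ⊤v-compatible = All.universal λ w _ _ → one-∈ w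

  ∧v-compatible : ∀ {W v v′} → Compatible* W v → Compatible* W v′ → Compatible* W (v ∧v v′)
  ∧v-compatible c c′ =
    All.zipWith (λ {w} (cw , cw′) p → ∧-closed (Admissible-isFilter p w) (cw p) (cw′ p)) (c , c′)

  update-compatible : ∀ {w p a} → Admissible p w a → Compatible w (⊤v [ p ≔ a ])
  update-compatible {w} {p} adm q with q ≟ p
  ... | yes refl = adm
  ... | no  _    = λ _ → one-∈ w

  update-compatible* : ∀ W {p a} → ⋂ (Admissible p) W a → Compatible* W (⊤v [ p ≔ a ])
  update-compatible* []      _            = []
  update-compatible* (w ∷ W) (adm , adm*) = update-compatible adm ∷ update-compatible* W adm*

  Induced : List Point → ℕ → Sub A
  Induced W p u = ∀ v → Compatible* W v → v p ∈ u

  ⟦_⟧[_] : Fm K → List Point → Sub A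
  ⟦ φ ⟧[ W ] = evalU A (Induced W) φ

  Induced⊆V : ∀ W p → _⊆U_ A (Induced W p) (V p)
  Induced⊆V W p u u∈Induced
    with Any.satisfied (meet-prime-⋂ (Admissible-isFilter p) u W λ {a} a∈⋂ →
           subst (_∈ u) (update-≡ ⊤v p a) (u∈Induced _ (update-compatible* W a∈⋂)))
  ... | w , Admissible⊆u with em {V p w}
  ...   | yes w∈Vp = V-upset p w u (λ a a∈w → Admissible⊆u λ _ → a∈w) w∈Vp
  ...   | no  w∉Vp = ⊥-elim (proj₂ (proper u) (Admissible⊆u (⊥-elim ∘ w∉Vp)))

  module _ (W : List Point) where

    Values : Fm K → Pred Carrier (lsuc lzero)
    Values χ a = Σ Val λ v → Compatible* W v × eval A v χ ≤ a

    Values-isFilter : ∀ χ → Positive χ → IsFilter₁ (Values χ)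
    Values-isFilter χ pos = record
      { up       = λ a≤b (v , c , χv≤a) → v , c , ≤-trans χv≤a a≤b
      ; ∧-closed = λ (v , c , χv≤a) (v′ , c′ , χv′≤b) →
          v ∧v v′ , ∧v-compatible c c′
        , ∧-greatest (≤-trans (eval-monotone χ pos (∧v-lowerˡ v v′)) χv≤a)
                     (≤-trans (eval-monotone χ pos (∧v-lowerʳ v v′)) χv′≤b)
      ; one∈     = ⊤v , ⊤v-compatible W , ≤-one _
      }

    Below : Fm K → Pred Carrier (lsuc lzero)
    Below ν a = Σ Val λ v → Compatible* W v × a ≤ eval A v ν

    Below-directed : ∀ ν → Negative ν → Directed (Below ν)
    Below-directed ν n (v , c , a≤νv) (v′ , c′ , b≤νv′) =
        eval A (v ∧v v′) ν , (v ∧v v′ , ∧v-compatible c c′ , ≤-refl _)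
      , ≤-trans a≤νv (eval-antitone ν n (∧v-lowerˡ v v′))
      , ≤-trans b≤νv′ (eval-antitone ν n (∧v-lowerʳ v v′))

    esakia-positive : ∀ χ → Positive χ → ∀ u → Compatible* W ⊆ (λ v → eval A v χ ∈ u) → ⟦ χ ⟧[ W ] u
    esakia-negative : ∀ ν → Negative ν → ∀ u → ⟦ ν ⟧[ W ] u
                    → Σ Val λ v → Compatible* W v × eval A v ν ∈ u
    refuting-valuation : ∀ χ → Positive χ → ∀ u → ¬ ⟦ χ ⟧[ W ] u
                       → Σ Val λ v → Compatible* W v × eval A v χ ∉ u
    extension-avoiding : ∀ φ → Positive φ → ∀ u {S} → Directed S → ∀ {s₀} → S s₀
                       → (∀ {f v a} → f ∈ u → Compatible* W v → (eval A v φ ∧ f) ≤ a → S a → ⊥)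
                       → Σ Point λ m → _⊑_ A u m × ⟦ φ ⟧[ W ] m × (∀ {a} → S a → a ∉ m)

    esakia-positive (var p)      _       u χ∈u = λ v c → χ∈u c
    esakia-positive 𝟙            _       u _   = lift tt
    esakia-positive (𝟘 h)        _       u χ∈u = ⊥-elim (zer-∉ u h (χ∈u (⊤v-compatible W)))
    esakia-positive (meet φ ψ)   (p , q) u χ∈u =
      esakia-positive φ p u (λ c → ∧-∈ˡ u (χ∈u c)) , esakia-positive ψ q u (λ c → ∧-∈ʳ u (χ∈u c))
    esakia-positive (join j φ ψ) (p , q) u χ∈u = dne λ u∉χ →
      let (v₁ , c₁ , φv₁∉u) = refuting-valuation φ p u (u∉χ ∘ inj₁)
          (v₂ , c₂ , ψv₂∉u) = refuting-valuation ψ q u (u∉χ ∘ inj₂)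
      in Sum.[ φv₁∉u ∘ ∈-up u (eval-monotone φ p (∧v-lowerˡ v₁ v₂))
             , ψv₂∉u ∘ ∈-up u (eval-monotone ψ q (∧v-lowerʳ v₁ v₂)) ]′
           (∨-prime j u (χ∈u (∧v-compatible c₁ c₂)))
    esakia-positive (imp h φ ψ)  (n , q) u χ∈u (u′ , u⊑u′ , u′∈φ , u′∉ψ) =
      let (v₀ , c₀ , φv₀∈u′) = esakia-negative φ n u′ u′∈φ
      in u′∉ψ (esakia-positive ψ q u′ λ {v} c →
           ∈-up u′ (eval-monotone ψ q (∧v-lowerˡ v v₀))
             (⇒-∈ u′ h (u⊑u′ _ (χ∈u (∧v-compatible c c₀)))
                       (∈-up u′ (eval-antitone φ n (∧v-lowerʳ v v₀)) φv₀∈u′)))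
    esakia-positive (neg h φ)    n       u χ∈u (u′ , u⊑u′ , u′∈φ , _) =
      let (v₀ , c₀ , φv₀∈u′) = esakia-negative φ n u′ u′∈φ
      in ¬-∉ u′ h (u⊑u′ _ (χ∈u c₀)) φv₀∈u′

    esakia-negative (var x)      ()
    esakia-negative 𝟙            _       u _ = ⊤v , ⊤v-compatible W , one-∈ u
    esakia-negative (𝟘 h)        _       u (lift ())
    esakia-negative (meet φ ψ)   (n , m) u (u∈φ , u∈ψ) =
      let (v₁ , c₁ , φv₁∈u) = esakia-negative φ n u u∈φ
          (v₂ , c₂ , ψv₂∈u) = esakia-negative ψ m u u∈ψ
      in v₁ ∧v v₂ , ∧v-compatible c₁ c₂
       , ∈-∧ u (∈-up u (eval-antitone φ n (∧v-lowerˡ v₁ v₂)) φv₁∈u)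
               (∈-up u (eval-antitone ψ m (∧v-lowerʳ v₁ v₂)) ψv₂∈u)
    esakia-negative (join j φ ψ) (n , m) u (inj₁ u∈φ) =
      let (v , c , φv∈u) = esakia-negative φ n u u∈φ in v , c , ∈-up u (x≤x∨y j _ _) φv∈u
    esakia-negative (join j φ ψ) (n , m) u (inj₂ u∈ψ) =
      let (v , c , ψv∈u) = esakia-negative ψ m u u∈ψ in v , c , ∈-up u (y≤x∨y j _ _) ψv∈u
    esakia-negative (imp h φ ψ)  (p , m) u u∈φ⇒ψ = dne λ none →
      let (u′ , u⊑u′ , u′∈φ , Below⊈u′) =
            extension-avoiding φ p u (Below-directed ψ m) (⊤v , ⊤v-compatible W , ≤-refl _)
              λ {f} {v} f∈u c φvf≤a (v′ , c′ , a≤ψv′) →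
                none (v ∧v v′ , ∧v-compatible c c′ , ∈-up u (residᵣ h _ _ f (∧-swap-≤
                  (≤-trans (∧-monoˡ f (eval-monotone φ p (∧v-lowerˡ v v′)))
                  (≤-trans φvf≤a (≤-trans a≤ψv′ (eval-antitone ψ m (∧v-lowerʳ v v′))))))) f∈u)
      in u∈φ⇒ψ (u′ , u⊑u′ , u′∈φ , λ u′∈ψ →
           let (v₀ , c₀ , ψv₀∈u′) = esakia-negative ψ m u′ u′∈ψ
           in Below⊈u′ (v₀ , c₀ , ≤-refl _) ψv₀∈u′)
    esakia-negative (neg h φ)    p       u u∈¬φ = dne λ none →
      let g = negBot K h
          (u′ , u⊑u′ , u′∈φ , _) =
            extension-avoiding φ p u (Below-directed (𝟘 g) tt) (⊤v , ⊤v-compatible W , ≤-refl _)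
              λ {f} {v} f∈u c φvf≤a (_ , _ , a≤0) →
                none (v , c , ∈-up u (pcᵣ h _ f (≤-zer⇒≡ g (≤-trans (∧-swap-≤ φvf≤a) a≤0))) f∈u)
      in u∈¬φ (u′ , u⊑u′ , u′∈φ , lower)

    refuting-valuation χ pos u u∉χ =
      ⊈-witness {P = Compatible* W} {Q = λ v → eval A v χ ∈ u} (u∉χ ∘ esakia-positive χ pos u)

    extension-avoiding φ pos u S-directed s₀∈S disjoint =
      let (m , B⊆m , S∉m) = separation zorn (∨ᶠ-isFilter (Values-isFilter φ pos) u) S-directed
                              (λ (_ , _ , (_ , c , φv≤g) , f∈u , gf≤a) →
                                 disjoint f∈u c (≤-trans (∧-monoˡ _ φv≤g) gf≤a))
                              s₀∈S
      in m , (λ _ a∈u → B⊆m (∨ᶠ-upperʳ (Values-isFilter φ pos) u a∈u))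
           , esakia-positive φ pos m (λ c → B⊆m (∨ᶠ-upperˡ u (_ , c , ≤-refl _)))
           , S∉m

  -- R holds at all W-compatible valuations below some W-compatible one, for every finite
  -- W constraining at least as much as W₀; this uniformity in W lets two such properties
  -- be combined.
  Eventually : ∀ {ℓ} → Pred Val ℓ → Set (lsuc lzero ⊔ ℓ)
  Eventually R = Σ (List Point) λ W₀ → ∀ W → Compatible* W ⊆ Compatible* W₀
               → Σ Val λ v → Compatible* W v × (∀ {v′} → Compatible* W v′ → v′ ≤v v → R v′)

  module _ {ℓ ℓ′} {R : Pred Val ℓ} {R′ : Pred Val ℓ′} where

    eventually-map : R ⊆ R′ → Eventually R → Eventually R′
    eventually-map R⊆R′ (W₀ , holds) = W₀ , λ W W⊆W₀ →
      let (v , c , below-v) = holds W W⊆W₀ in v , c , λ c′ v′≤v → R⊆R′ (below-v c′ v′≤v)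

    eventually-× : Eventually R → Eventually R′ → Eventually (R ∩ R′)
    eventually-× (W₁ , holds₁) (W₂ , holds₂) = W₁ ++ W₂ , λ W W⊆W₁₂ →
      let (v₁ , c₁ , below-v₁) = holds₁ W (λ c → proj₁ (++⁻ W₁ (W⊆W₁₂ c)))
          (v₂ , c₂ , below-v₂) = holds₂ W (λ c → proj₂ (++⁻ W₁ (W⊆W₁₂ c)))
      in v₁ ∧v v₂ , ∧v-compatible c₁ c₂
       , λ c′ v′≤v → below-v₁ c′ (λ p → ≤-trans (v′≤v p) (x∧y≤x _ _))
                   , below-v₂ c′ (λ p → ≤-trans (v′≤v p) (x∧y≤y _ _))

  eventually-always : ∀ {ℓ} {R : Pred Val ℓ} → (∀ v → R v) → Eventually R
  eventually-always R-holds = [] , λ W _ → ⊤v , ⊤v-compatible W , λ _ _ → R-holds _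

  eventually-∀ : ∀ {ℓ} n {R : Fin n → Pred Val ℓ} → (∀ i → Eventually (R i))
               → Eventually (λ v → ∀ i → R i v)
  eventually-∀ ℕ.zero    _     = eventually-always λ _ ()
  eventually-∀ (ℕ.suc n) holds =
    eventually-map (λ (r₀ , rₛ) → λ { zero → r₀ ; (suc i) → rₛ i })
      (eventually-× (holds zero) (eventually-∀ n (holds ∘ suc)))

  eventually-witness : ∀ {ℓ} {R : Pred Val ℓ} → Eventually R → Σ Val R
  eventually-witness (W₀ , holds) = let (v , c , below-v) = holds W₀ id in v , below-v c (≤v-refl v)

  positive-refuted : ∀ χ → Positive χ → ∀ u → ¬ ⟦ χ ⟧ u → Eventually (λ v → eval A v χ ∉ u)
  positive-refuted χ pos u u∉χ = [] , λ W _ →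
    let (v , c , χv∉u) = refuting-valuation W χ pos u
                           (u∉χ ∘ evalU-monotone χ pos (Induced⊆V W) u)
    in v , c , λ _ v′≤v χv′∈u → χv∉u (∈-up u (eval-monotone χ pos v′≤v) χv′∈u)

  antecedent-realised : ∀ {α} → SAnte α → ∀ w → ⟦ α ⟧ w → Eventually (λ v → eval A v α ∈ w)
  antecedent-realised (sa-var p)       w w∈p = (w ∷ []) , λ W W⊆w →
    ⊤v , ⊤v-compatible W , λ c _ → All.head (W⊆w c) p w∈p
  antecedent-realised (sa-negf ν n)    w w∈ν = [] , λ W _ →
    let (v₀ , c₀ , νv₀∈w) = esakia-negative W ν n w (evalU-antitone ν n (Induced⊆V W) w w∈ν)
    in v₀ , c₀ , λ _ v′≤v₀ → ∈-up w (eval-antitone ν n v′≤v₀) νv₀∈w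
  antecedent-realised sa-top           w _   = eventually-always λ _ → one-∈ w
  antecedent-realised (sa-bot h)       w (lift ())
  antecedent-realised (sa-meet α β)    w (w∈α , w∈β) =
    eventually-map (λ (α∈w , β∈w) → ∈-∧ w α∈w β∈w)
      (eventually-× (antecedent-realised α w w∈α) (antecedent-realised β w w∈β))
  antecedent-realised (sa-join j α β)  w (inj₁ w∈α) =
    eventually-map (∈-up w (x≤x∨y j _ _)) (antecedent-realised α w w∈α)
  antecedent-realised (sa-join j α β)  w (inj₂ w∈β) =
    eventually-map (∈-up w (y≤x∨y j _ _)) (antecedent-realised β w w∈β)

  implication-refuted : ∀ {φ} → SImp φ → ∀ x → ¬ ⟦ φ ⟧ x → Eventually (λ v → eval A v φ ∉ x)
  implication-refuted (si-pos φ pos)   = positive-refuted φ pos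
  implication-refuted (si-neg h α)     x x∉¬α =
    let (x′ , x⊑x′ , x′∈α , _) = dne x∉¬α
    in eventually-map (λ α∈x′ ¬α∈x → ¬-∉ x′ h (x⊑x′ _ ¬α∈x) α∈x′) (antecedent-realised α x′ x′∈α)
  implication-refuted (si-imp h {ψ = ψ} α pos) x x∉α⇒ψ =
    let (x′ , x⊑x′ , x′∈α , x′∉ψ) = dne x∉α⇒ψ
    in eventually-map (λ (α∈x′ , ψ∉x′) α⇒ψ∈x → ψ∉x′ (⇒-∈ x′ h (x⊑x′ _ α⇒ψ∈x) α∈x′))
         (eventually-× (antecedent-realised α x′ x′∈α) (positive-refuted ψ pos x′ x′∉ψ))

  combination-refuted : ∀ {φ} → SComb φ → ∀ x → ¬ ⟦ φ ⟧ x → Eventually (λ v → eval A v φ ∉ x)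
  combination-refuted (sc-imp σ)            = implication-refuted σ
  combination-refuted (sc-meet {φ} σ τ)   x x∉ with em {⟦ φ ⟧ x}
  ... | yes x∈φ = eventually-map (λ ψ∉x → ψ∉x ∘ ∧-∈ʳ x) (combination-refuted τ x (x∉ ∘ (x∈φ ,_)))
  ... | no  x∉φ = eventually-map (λ φ∉x → φ∉x ∘ ∧-∈ˡ x) (combination-refuted σ x x∉φ)
  combination-refuted (sc-join j σ τ)     x x∉ =
    eventually-map (λ (φ∉x , ψ∉x) → Sum.[ φ∉x , ψ∉x ]′ ∘ ∨-prime j x)
      (eventually-× (combination-refuted σ x (x∉ ∘ inj₁)) (combination-refuted τ x (x∉ ∘ inj₂)))

module Validity (em : ExcludedMiddle (lsuc lzero)) {K : Variety} (A : KAlgebra K)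
                (Φ : SahlqvistQE K) (valid : Validates A Φ) where
  open SahlqvistQE Φ
  open KAlgebra A
  open Order A
  open Valuations A
  open Points A
  open Classical em
  open Filters em A

  valid-at : ∀ v b c → (∀ i → (eval A v (φ i) ∧ b) ≤ c) → b ≤ c
  valid-at v b c φ∧b≤c = subst₂ _≤_ v*y≡b v*z≡c (valid v* λ i →
      subst₂ _≤_ (sym (cong₂ _∧_ (eval-cong (φ i) (agrees i)) v*y≡b)) (sym v*z≡c) (φ∧b≤c i))
    where
    v* : Val
    v* = (v [ y ≔ b ]) [ z ≔ c ]

    v*y≡b : v* y ≡ b
    v*y≡b = trans (update-≢ (v [ y ≔ b ]) c y≢z) (update-≡ v y b)

    v*z≡c : v* z ≡ c
    v*z≡c = update-≡ _ z c

    agrees : ∀ i q → Occurs q (φ i) → v* q ≡ v q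
    agrees i q q∈φ = trans (update-≢ (v [ y ≔ b ]) {z} {q} c λ { refl → z-fresh i q∈φ })
                           (update-≢ v {y} {q} b λ { refl → y-fresh i q∈φ })

  antecedents-not-all-∉ : (x : Point) (v : Val) → ¬ (∀ i → eval A v (φ i) ∉ x)
  antecedents-not-all-∉ x v φ∉x =
    let (c , c∈G , c∉x) = ⊈-witness {P = λ c → ∀ i → G i c} {Q = _∈ x} λ G⊆x →
          let (i , Gi⊆x) = Anyₚ.tabulate⁻ {f = id}
                             (meet-prime-⋂ G-filter x (tabulate id) (G⊆x ∘ ⋂-tabulate⁻ id))
          in φ∉x i (Gi⊆x (∨ᶠ-upperˡ x (lift (≤-refl _))))
    in c∉x (G-closed c∈G)
    where
    G : Fin (ℕ.suc m) → Pred Carrier (lsuc lzero)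
    G i = (↑ eval A v (φ i)) ∨ᶠ x

    G-filter : ∀ i → IsFilter₁ (G i)
    G-filter i = ∨ᶠ-isFilter (↑-isFilter _) x

    G-closed : ∀ {c} → (∀ i → G i c) → c ∈ x
    G-closed {c} c∈G = ∈-up x (valid-at v (⋀ _ f) c λ i →
        let (_ , _ , lift φ≤g , _ , g∧f≤c) = c∈G i
        in ≤-trans (∧-mono φ≤g (⋀-lower _ f i)) g∧f≤c)
      (⋀-∈ x _ λ i → let (_ , _ , _ , f∈x , _) = c∈G i in f∈x)
      where
      f : Fin (ℕ.suc m) → Carrier
      f i = proj₁ (proj₂ (c∈G i))

  some-antecedent-holds : Zorn (lsuc lzero) → (V : ℕ → Sub A) → (∀ p → IsUpset A (V p))
                        → ∀ x → Σ (Fin (ℕ.suc m)) λ i → evalU A V (φ i) x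
  some-antecedent-holds zorn V V-upset x = dne λ none →
    let (v , φ∉x) = eventually-witness (eventually-∀ _ λ i →
                      combination-refuted (sahl i) x (none ∘ (i ,_)))
    in antecedents-not-all-∉ x v φ∉x
    where open Sahlqvist em zorn A V V-upset

proposition5p3 : ExcludedMiddle (lsuc lzero) → Zorn (lsuc lzero)
    → (K : Variety) (Φ : SahlqvistQE K) (A : KAlgebra K)
    → Validates A Φ → UpValidates A Φ
proposition5p3 em zorn K Φ A valid V V-upset φ∧y≤z = (λ _ → proj₁) , λ x x∈y → x∈y , x∈z x x∈y
  where
  open SahlqvistQE Φ

  x∈z : ∀ x → V y x → V z x
  x∈z x x∈y = let (i , x∈φ) = Validity.some-antecedent-holds em A Φ valid zorn V V-upset x
              in proj₂ (proj₂ (φ∧y≤z i) x (x∈φ , x∈y))
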